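{- Let $p\ge 3$ be an integer, $t=2p-2$, and let $G$ be a simple undirected graph in which every vertex has degree at most $t+1$. Let $H$ be a dense subgraph of $G$ with core $C_H$ of size $2k$, and let $M\subseteq E(H)$ be such that every vertex of $C_H$ is incident to at least one edge of $M$. Then the following are equivalent: (1) $M$ covers every $K^p_2$ contained in $H$; (2) $M$ is not a perfect matching of $G[C_H]$; (3) some vertex of $C_H$ is incident to at least two edges of $M$, or some edge of $M$ is incident to a vertex of $V(H)\setminus C_H$.
   Context: $K^p_2$ is the complete $p$-partite graph with $p$ color classes of $2$ vertices each; a "$K^p_2$" of a graph is a subgraph (not necessarily induced) isomorphic to it. For $A\subseteq V(G)$ with $|A|=2p$, $G[A]$ is dense if it contains at least two different $K^p_2$'s; its core is $C_{G[A]}=\{a\in A:$ all neighbours of $a$ in $G$ lie in $A$ and $\deg_G(a)=t+1\}$. An edge set covers a subgraph if it contains at least one of its edges. A perfect matching of $G[C_H]$ is a set of edges of $G[C_H]$ such that every vertex of $C_H$ is incident to exactly one of them. -}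

module Defs where

open import Data.Nat using (ℕ; _≟_)
open import Data.Bool using (Bool; true; false; _∧_)
open import Data.Fin using (Fin)
open import Data.Fin.Subset using (Subset; _∈_; _⊆_; ∣_∣)
open import Data.Fin.Subset.Properties using (_∈?_; _⊆?_)
open import Data.Vec using (tabulate)
open import Data.Product using (Σ; ∃; _×_)
open import Relation.Nullary using (¬_; ⌊_⌋)
open import Relation.Binary.PropositionalEquality using (_≡_; _≢_)
open import Function.Bundles using (_⇔_)

record Graph (n : ℕ) : Set where
  field
    adj    : Fin n → Fin n → Bool
    sym    : ∀ u v → adj u v ≡ adj v u
    irrefl : ∀ u → adj u u ≡ false

module _ {n : ℕ} (G : Graph n) where
  open Graph G

  Edge : Fin n → Fin n → Set
  Edge u v = adj u v ≡ true

  nbhd : Fin n → Subset n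
  nbhd u = tabulate (adj u)

  deg : Fin n → ℕ
  deg u = ∣ nbhd u ∣

  -- A copy of K^p_2 in G[A]: an injective map from the vertices of K^p_2
  -- (p colour classes of 2 vertices) into A, sending edges to edges.
  record K2 (p : ℕ) (A : Subset n) : Set where
    field
      φ     : Fin p → Fin 2 → Fin n
      inj   : ∀ i a j b → φ i a ≡ φ j b → (i ≡ j × a ≡ b)
      inA   : ∀ i a → φ i a ∈ A
      edges : ∀ i j a b → i ≢ j → Edge (φ i a) (φ j b)

  KEdge : ∀ {p A} → K2 p A → Fin n → Fin n → Set
  KEdge K u v = Σ _ λ i → Σ _ λ j → Σ (Fin 2) λ a → Σ (Fin 2) λ b →
                  i ≢ j × u ≡ K2.φ K i a × v ≡ K2.φ K j b

  Different : ∀ {p A} → K2 p A → K2 p A → Set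
  Different K L = ¬ (∀ u v → KEdge K u v ⇔ KEdge L u v)

  Dense : (p : ℕ) → Subset n → Set
  Dense p A = (∣ A ∣ ≡ 2 Data.Nat.* p) × Σ (K2 p A) λ K → Σ (K2 p A) λ L → Different K L

  -- core of G[A] (t+1 passed as parameter d)
  isCore : ℕ → Subset n → Fin n → Bool
  isCore d A a = ⌊ a ∈? A ⌋ ∧ (⌊ nbhd a ⊆? A ⌋ ∧ ⌊ deg a ≟ d ⌋)

  core : ℕ → Subset n → Subset n
  core d A = tabulate (isCore d A)

  Covers : ∀ {p A} → (Fin n → Fin n → Bool) → K2 p A → Set
  Covers M K = ∃ λ u → ∃ λ v → KEdge K u v × M u v ≡ true

  PerfectMatching : Subset n → (Fin n → Fin n → Bool) → Set
  PerfectMatching C M =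
    (∀ u v → M u v ≡ true → Edge u v × u ∈ C × v ∈ C) ×
    (∀ c → c ∈ C → ∃ λ v → M c v ≡ true × (∀ w → M c w ≡ true → w ≡ v))

-- Every degree is at most t + 1 = |A| - 1, so a vertex of A is in the core exactly when it is
-- adjacent to all other vertices of A. A copy K of K^p_2 fills A, hence a vertex is in the core
-- exactly when it is adjacent to its classmate in K.
-- If M covers no copy, every M-edge joins two classmates of a fixed copy; then all M-vertices
-- are core vertices and each core vertex has its classmate as unique partner, so M is a perfect
-- matching of G[C]. Conversely, given a perfect matching and any copy, treat the classes one at
-- a time: if a class meets the core but is not an M-edge, transpose the classmate of a core vertex
-- with its M-partner. Both are core vertices, hence adjacent to everything, so the result is
-- again a copy; at the end every class avoids the core or is an M-edge, and that copy is not
-- covered. Conditions (2) and (3) are a decidable unfolding of "perfect matching".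

module Submission where

open import Defs
open import Data.Bool using (Bool; true)
import Data.Bool as Bool
open import Data.Empty using (⊥-elim)
open import Data.Fin using (Fin; zero; suc; remQuot; combine)
open import Data.Fin.Properties using (any?; 0≢1+n; suc-injective; combine-remQuot) renaming (_≟_ to _≟ᶠ_)
open import Data.Fin.Permutation.Components using (transpose; transpose-inverse)
open import Data.Fin.Subset using (Subset; _∈_; _∉_; _⊆_; ∣_∣; _-_; inside; outside)
open import Data.Fin.Subset.Properties using (_∈?_; _⊆?_; p─⊥≡p; p─q⊆p; x∈p∧x≢y⇒x∈p-y; x∈p⇒∣p-x∣<∣p∣; p⊂q⇒∣p∣<∣q∣; p⊆q⇒∣p∣≤∣q∣)
open import Data.List using (List; []; _∷_; allFin)
open import Data.List.Membership.Propositional.Properties using (∈-allFin)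
open import Data.List.Relation.Unary.All as All using (All; []; _∷_)
open import Data.Nat using (ℕ; zero; suc; _≟_; _≤_; _<_; _+_; _*_; _∸_; z≤n; s≤s)
open import Data.Nat.Properties using (≤-trans; ≤-reflexive; ≤-antisym; <-irrefl; ≤-<-trans; <-≤-trans; +-suc; *-comm; *-monoʳ-≤; m∸n+n≡m)
  renaming (suc-injective to ℕ-suc-injective)
open import Data.Product using (Σ; ∃; ∃₂; _×_; _,_; proj₁; proj₂; uncurry)
open import Data.Sum using (_⊎_; inj₁; inj₂; [_,_]′)
open import Data.Vec using (_∷_; tabulate; here; there)
open import Data.Vec.Properties using ([]=⇒lookup; lookup⇒[]=; lookup∘tabulate)
open import Function using (_∘_)
open import Function.Bundles using (_⇔_; mk⇔)
open import Relation.Nullary using (¬_; Dec; yes; no)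
open import Relation.Nullary.Decidable using (_×-dec_; ¬?; map′)
open import Relation.Binary.PropositionalEquality

∈-tabulate⁺ : ∀ {n} (f : Fin n → Bool) {x} → f x ≡ true → x ∈ tabulate f
∈-tabulate⁺ f {x} fx = lookup⇒[]= x (tabulate f) (trans (lookup∘tabulate f x) fx)

∈-tabulate⁻ : ∀ {n} (f : Fin n → Bool) {x} → x ∈ tabulate f → f x ≡ true
∈-tabulate⁻ f {x} x∈ = trans (sym (lookup∘tabulate f x)) ([]=⇒lookup x∈)

suc∣p-x∣≡∣p∣ : ∀ {n} {p : Subset n} {x} → x ∈ p → suc ∣ p - x ∣ ≡ ∣ p ∣
suc∣p-x∣≡∣p∣ {p = inside ∷ p}  here        = cong (suc ∘ ∣_∣) (p─⊥≡p p)
suc∣p-x∣≡∣p∣ {p = inside ∷ p}  (there x∈p) = cong suc (suc∣p-x∣≡∣p∣ x∈p)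
suc∣p-x∣≡∣p∣ {p = outside ∷ p} (there x∈p) = suc∣p-x∣≡∣p∣ x∈p

x∉p-x : ∀ {n} (p : Subset n) x → x ∉ p - x
x∉p-x (_ ∷ p) zero    ()
x∉p-x (_ ∷ p) (suc x) (there x∈p-x) = x∉p-x p x x∈p-x

injective∧missing⇒<∣p∣ : ∀ {m n} (f : Fin m → Fin n) → (∀ {i j} → f i ≡ f j → i ≡ j) →
                         (S : Subset n) → (∀ i → f i ∈ S) →
                         ∀ {z} → z ∈ S → (∀ i → f i ≢ z) → m < ∣ S ∣
injective∧missing⇒<∣p∣ {zero}  f inj S f∈S z∈S f≢z = ≤-<-trans z≤n (x∈p⇒∣p-x∣<∣p∣ z∈S)
injective∧missing⇒<∣p∣ {suc m} f inj S f∈S z∈S f≢z =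
  ≤-trans (s≤s m<∣S-f₀∣) (x∈p⇒∣p-x∣<∣p∣ (f∈S zero))
  where
  m<∣S-f₀∣ : m < ∣ S - f zero ∣
  m<∣S-f₀∣ = injective∧missing⇒<∣p∣ (f ∘ suc) (suc-injective ∘ inj) (S - f zero)
    (λ i → x∈p∧x≢y⇒x∈p-y (f∈S (suc i)) (0≢1+n ∘ sym ∘ inj))
    (x∈p∧x≢y⇒x∈p-y z∈S (f≢z zero ∘ sym)) (f≢z ∘ suc)

transpose-image : ∀ {n} (i j k : Fin n) →
                  transpose i j k ≡ k ⊎ transpose i j k ≡ i ⊎ transpose i j k ≡ j
transpose-image i j k with k ≟ᶠ i
... | yes _ = inj₂ (inj₂ refl)
... | no _ with k ≟ᶠ j
...   | yes _ = inj₂ (inj₁ refl)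
...   | no _  = inj₁ refl

transpose-matchʳ : ∀ {n} (i j : Fin n) → transpose i j j ≡ i
transpose-matchʳ i j with j ≟ᶠ i
... | yes j≡i = j≡i
... | no _ with j ≟ᶠ j
...   | yes _   = refl
...   | no j≢j = ⊥-elim (j≢j refl)

transpose-fix : ∀ {n} {i j k : Fin n} → k ≢ i → k ≢ j → transpose i j k ≡ k
transpose-fix {i = i} {j} {k} k≢i k≢j with k ≟ᶠ i
... | yes k≡i = ⊥-elim (k≢i k≡i)
... | no _ with k ≟ᶠ j
...   | yes k≡j = ⊥-elim (k≢j k≡j)
...   | no _    = refl

transpose-injective : ∀ {n} (i j : Fin n) {k l} → transpose i j k ≡ transpose i j l → k ≡ l
transpose-injective i j {k} {l} eq =
  trans (sym (transpose-inverse j i)) (trans (cong (transpose j i) eq) (transpose-inverse j i))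

other : Fin 2 → Fin 2
other zero       = suc zero
other (suc zero) = zero

≢⇒≡other : ∀ {a b : Fin 2} → a ≢ b → b ≡ other a
≢⇒≡other {zero}     {zero}     a≢b = ⊥-elim (a≢b refl)
≢⇒≡other {zero}     {suc zero} _   = refl
≢⇒≡other {suc zero} {zero}     _   = refl
≢⇒≡other {suc zero} {suc zero} a≢b = ⊥-elim (a≢b refl)

≢-≢⇒≡ : ∀ {a b c : Fin 2} → a ≢ b → a ≢ c → b ≡ c
≢-≢⇒≡ a≢b a≢c = trans (≢⇒≡other a≢b) (sym (≢⇒≡other a≢c))

module _ {n : ℕ} (G : Graph n) where
  open Graph G using (adj; irrefl)

  Edge-irrefl : ∀ {u v} → Edge G u v → u ≢ v
  Edge-irrefl {u} e refl with trans (sym e) (irrefl u)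
  ... | ()

  Edge-sym : ∀ {u v} → Edge G u v → Edge G v u
  Edge-sym {u} {v} e = trans (Graph.sym G v u) e

  ∈-nbhd⁺ : ∀ {u v} → Edge G u v → v ∈ nbhd G u
  ∈-nbhd⁺ {u} = ∈-tabulate⁺ (adj u)

  ∈-nbhd⁻ : ∀ {u v} → v ∈ nbhd G u → Edge G u v
  ∈-nbhd⁻ {u} = ∈-tabulate⁻ (adj u)

  ∈-core⁻ : ∀ {d A x} → x ∈ core G d A → x ∈ A × nbhd G x ⊆ A × deg G x ≡ d
  ∈-core⁻ {d} {A} {x} x∈C with x ∈? A | nbhd G x ⊆? A | deg G x ≟ d | ∈-tabulate⁻ (isCore G d A) x∈C
  ... | yes x∈A | yes N⊆A | yes deg≡d | _ = x∈A , N⊆A , deg≡d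
  ... | no _    | _       | _         | ()
  ... | yes _   | no _    | _         | ()
  ... | yes _   | yes _   | no _      | ()

  ∈-core⁺ : ∀ {d A x} → x ∈ A → nbhd G x ⊆ A → deg G x ≡ d → x ∈ core G d A
  ∈-core⁺ {d} {A} {x} x∈A N⊆A deg≡d = ∈-tabulate⁺ (isCore G d A) isCore≡true
    where
    isCore≡true : isCore G d A x ≡ true
    isCore≡true with x ∈? A | nbhd G x ⊆? A | deg G x ≟ d
    ... | yes _ | yes _ | yes _  = refl
    ... | no ∉  | _     | _      = ⊥-elim (∉ x∈A)
    ... | yes _ | no ⊈  | _      = ⊥-elim (⊈ N⊆A)
    ... | yes _ | yes _ | no ≢   = ⊥-elim (≢ deg≡d)

module _ {n : ℕ} (A C : Subset n) (M : Fin n → Fin n → Bool) where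

  DoublyMatched : Set
  DoublyMatched = ∃ λ c → c ∈ C × ∃ λ v → ∃ λ w → v ≢ w × M c v ≡ true × M c w ≡ true

  TouchesNonCore : Set
  TouchesNonCore = ∃ λ u → ∃ λ v → M u v ≡ true × u ∈ A × u ∉ C

  doublyMatched? : Dec DoublyMatched
  doublyMatched? = any? λ c → (c ∈? C) ×-dec any? λ v → any? λ w →
    ¬? (v ≟ᶠ w) ×-dec (M c v Bool.≟ true) ×-dec (M c w Bool.≟ true)

  touchesNonCore? : Dec TouchesNonCore
  touchesNonCore? = any? λ u → any? λ v → (M u v Bool.≟ true) ×-dec (u ∈? A) ×-dec ¬? (u ∈? C)

  module _ (G : Graph n) (M-sym : ∀ u v → M u v ≡ M v u)
           (M⊆E[A] : ∀ u v → M u v ≡ true → Edge G u v × u ∈ A × v ∈ A) where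

    ¬doublyMatched∧¬touchesNonCore⇒perfectMatching : (∀ c → c ∈ C → ∃ λ v → M c v ≡ true) →
      ¬ DoublyMatched → ¬ TouchesNonCore → PerfectMatching G C M
    ¬doublyMatched∧¬touchesNonCore⇒perfectMatching M-covers-C ¬doubly ¬touches =
      matched⇒in-C , unique-partner
      where
      matched⇒core : ∀ {u v} → M u v ≡ true → u ∈ C
      matched⇒core {u} {v} m with u ∈? C
      ... | yes u∈C = u∈C
      ... | no u∉C  = ⊥-elim (¬touches (u , v , m , proj₁ (proj₂ (M⊆E[A] u v m)) , u∉C))
      matched⇒in-C : ∀ u v → M u v ≡ true → Edge G u v × u ∈ C × v ∈ C
      matched⇒in-C u v m = proj₁ (M⊆E[A] u v m) , matched⇒core m , matched⇒core (trans (M-sym v u) m)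
      unique-partner : ∀ c → c ∈ C → ∃ λ v → M c v ≡ true × (∀ w → M c w ≡ true → w ≡ v)
      unique-partner c c∈C with M-covers-C c c∈C
      ... | v , cMv = v , cMv , same-partner
        where
        same-partner : ∀ w → M c w ≡ true → w ≡ v
        same-partner w cMw with w ≟ᶠ v
        ... | yes w≡v = w≡v
        ... | no w≢v  = ⊥-elim (¬doubly (c , c∈C , w , v , w≢v , cMw , cMv))

    ¬perfectMatching⇔doublyMatched⊎touchesNonCore : (∀ c → c ∈ C → ∃ λ v → M c v ≡ true) →
      (¬ PerfectMatching G C M) ⇔ (DoublyMatched ⊎ TouchesNonCore)
    ¬perfectMatching⇔doublyMatched⊎touchesNonCore M-covers-C = mk⇔ to from
      where
      to : ¬ PerfectMatching G C M → DoublyMatched ⊎ TouchesNonCore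
      to ¬pm with doublyMatched? | touchesNonCore?
      ... | yes doubly | _           = inj₁ doubly
      ... | no _       | yes touches = inj₂ touches
      ... | no ¬doubly | no ¬touches =
        ⊥-elim (¬pm (¬doublyMatched∧¬touchesNonCore⇒perfectMatching M-covers-C ¬doubly ¬touches))
      from : DoublyMatched ⊎ TouchesNonCore → ¬ PerfectMatching G C M
      from (inj₁ (c , c∈C , v , w , v≢w , cMv , cMw)) (_ , unique) with unique c c∈C
      ... | _ , _ , partner = v≢w (trans (partner v cMv) (sym (partner w cMw)))
      from (inj₂ (u , v , m , _ , u∉C)) (in-C , _) = u∉C (proj₁ (proj₂ (in-C u v m)))

module Saturated {n : ℕ} (G : Graph n) {d : ℕ} (deg≤d : ∀ v → deg G v ≤ d)
                 {A : Subset n} (∣A∣≡1+d : ∣ A ∣ ≡ suc d) where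
  open Graph G using (adj)

  C : Subset n
  C = core G d A

  ∣A-x∣≡d : ∀ {x} → x ∈ A → ∣ A - x ∣ ≡ d
  ∣A-x∣≡d x∈A = ℕ-suc-injective (trans (suc∣p-x∣≡∣p∣ x∈A) ∣A∣≡1+d)

  core⇒adjacent : ∀ {x y} → x ∈ C → y ∈ A → x ≢ y → Edge G x y
  core⇒adjacent {x} {y} x∈C y∈A x≢y with adj x y Bool.≟ true
  ... | yes xy = xy
  ... | no ¬xy =
    ⊥-elim (<-irrefl refl (<-≤-trans deg<∣A-y∣ (≤-reflexive (trans (∣A-x∣≡d y∈A) (sym deg≡d)))))
    where
    x∈A = proj₁ (∈-core⁻ G x∈C)
    N⊆A = proj₁ (proj₂ (∈-core⁻ G x∈C))
    deg≡d = proj₂ (proj₂ (∈-core⁻ G x∈C))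
    N⊆A-y : nbhd G x ⊆ A - y
    N⊆A-y z∈N = x∈p∧x≢y⇒x∈p-y (N⊆A z∈N) (λ { refl → ¬xy (∈-nbhd⁻ G z∈N) })
    deg<∣A-y∣ : deg G x < ∣ A - y ∣
    deg<∣A-y∣ = p⊂q⇒∣p∣<∣q∣ (N⊆A-y , x , x∈p∧x≢y⇒x∈p-y x∈A x≢y ,
                             λ x∈N → Edge-irrefl G (∈-nbhd⁻ G x∈N) refl)

  adjacent⇒core : ∀ {x} → x ∈ A → (∀ {y} → y ∈ A → y ≢ x → Edge G x y) → x ∈ C
  adjacent⇒core {x} x∈A x~A = ∈-core⁺ G x∈A N⊆A deg≡d
    where
    A-x⊆N : A - x ⊆ nbhd G x
    A-x⊆N {y} y∈A-x = ∈-nbhd⁺ G (x~A (p─q⊆p A _ y∈A-x) (λ { refl → x∉p-x A x y∈A-x }))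
    N⊆A : nbhd G x ⊆ A
    N⊆A {z} z∈N with z ∈? A
    ... | yes z∈A = z∈A
    ... | no z∉A = ⊥-elim (<-irrefl refl (≤-trans ∣A-x∣<deg (deg≤d x)))
      where
      ∣A-x∣<deg : d < deg G x
      ∣A-x∣<deg = subst (_< deg G x) (∣A-x∣≡d x∈A)
                    (p⊂q⇒∣p∣<∣q∣ (A-x⊆N , z , z∈N , z∉A ∘ p─q⊆p A _))
    deg≡d : deg G x ≡ d
    deg≡d = ≤-antisym (deg≤d x) (subst (_≤ deg G x) (∣A-x∣≡d x∈A) (p⊆q⇒∣p∣≤∣q∣ A-x⊆N))

  K2-map : ∀ {p} (σ : Fin n → Fin n) → (∀ {x y} → σ x ≡ σ y → x ≡ y) →
           (∀ x → σ x ≡ x ⊎ σ x ∈ C) → K2 G p A → K2 G p A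
  K2-map σ σ-injective σ-image K = record
    { φ     = λ i a → σ (φ i a)
    ; inj   = λ i a j b → inj i a j b ∘ σ-injective
    ; inA   = λ i a → σ∈A (inA i a)
    ; edges = edges′
    }
    where
    open K2 K
    σ∈A : ∀ {x} → x ∈ A → σ x ∈ A
    σ∈A {x} x∈A with σ-image x
    ... | inj₁ σx≡x = subst (_∈ A) (sym σx≡x) x∈A
    ... | inj₂ σx∈C = proj₁ (∈-core⁻ G σx∈C)
    edges′ : ∀ i j a b → i ≢ j → Edge G (σ (φ i a)) (σ (φ j b))
    edges′ i j a b i≢j with σ-image (φ i a) | σ-image (φ j b)
    ... | inj₂ σx∈C | _         = core⇒adjacent σx∈C (σ∈A (inA j b)) σx≢σy
      where σx≢σy = λ eq → i≢j (proj₁ (inj i a j b (σ-injective eq)))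
    ... | inj₁ _    | inj₂ σy∈C = Edge-sym G (core⇒adjacent σy∈C (σ∈A (inA i a)) σy≢σx)
      where σy≢σx = λ eq → i≢j (proj₁ (inj i a j b (σ-injective (sym eq))))
    ... | inj₁ σx≡x | inj₁ σy≡y = subst₂ (Edge G) (sym σx≡x) (sym σy≡y) (edges i j a b i≢j)

  K2-swap : ∀ {p v w} → v ∈ C → w ∈ C → K2 G p A → K2 G p A
  K2-swap {v = v} {w} v∈C w∈C = K2-map (transpose v w) (transpose-injective v w) τ-image
    where
    τ-image : ∀ x → transpose v w x ≡ x ⊎ transpose v w x ∈ C
    τ-image x with transpose-image v w x
    ... | inj₁ τx≡x        = inj₁ τx≡x
    ... | inj₂ (inj₁ τx≡v) = inj₂ (subst (_∈ C) (sym τx≡v) v∈C)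
    ... | inj₂ (inj₂ τx≡w) = inj₂ (subst (_∈ C) (sym τx≡w) w∈C)

  module _ {p : ℕ} (∣A∣≡2p : ∣ A ∣ ≡ 2 * p) where

    K2-surjective : (K : K2 G p A) → ∀ {z} → z ∈ A → ∃₂ λ i a → K2.φ K i a ≡ z
    K2-surjective K {z} z∈A with any? (λ i → any? (λ a → K2.φ K i a ≟ᶠ z))
    ... | yes hit  = hit
    ... | no ¬hit = ⊥-elim (<-irrefl (sym (trans ∣A∣≡2p (*-comm 2 p))) p*2<∣A∣)
      where
      open K2 K
      flat : Fin (p * 2) → Fin n
      flat = uncurry φ ∘ remQuot 2
      uncurry-φ-injective : ∀ {x y} → uncurry φ x ≡ uncurry φ y → x ≡ y
      uncurry-φ-injective {i , a} {j , b} eq with inj i a j b eq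
      ... | refl , refl = refl
      flat-injective : ∀ {k l} → flat k ≡ flat l → k ≡ l
      flat-injective {k} {l} eq = begin
        k                                 ≡⟨ combine-remQuot {p} 2 k ⟨
        uncurry combine (remQuot {p} 2 k) ≡⟨ cong (uncurry combine) (uncurry-φ-injective eq) ⟩
        uncurry combine (remQuot {p} 2 l) ≡⟨ combine-remQuot {p} 2 l ⟩
        l                                 ∎
        where open ≡-Reasoning
      p*2<∣A∣ : p * 2 < ∣ A ∣
      p*2<∣A∣ = injective∧missing⇒<∣p∣ flat flat-injective A (λ _ → inA _ _) z∈A
                  (λ k eq → ¬hit (_ , _ , eq))

    φ-distinct-in-class : (K : K2 G p A) → ∀ {i a b} → a ≢ b → K2.φ K i a ≢ K2.φ K i b
    φ-distinct-in-class K {i} {a} {b} a≢b eq = a≢b (proj₂ (K2.inj K i a i b eq))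

    adjacent-mate⇒core : (K : K2 G p A) → ∀ {i a b} → a ≢ b →
                         Edge G (K2.φ K i a) (K2.φ K i b) → K2.φ K i a ∈ C
    adjacent-mate⇒core K {i} {a} {b} a≢b mate = adjacent⇒core (inA i a) φia~A
      where
      open K2 K
      φia~A : ∀ {y} → y ∈ A → y ≢ φ i a → Edge G (φ i a) y
      φia~A y∈A y≢φia with K2-surjective K y∈A
      ... | k , c , refl with k ≟ᶠ i
      ... | no k≢i  = edges i k a c (k≢i ∘ sym)
      ... | yes refl = subst (λ c → Edge G (φ i a) (φ i c)) (≢-≢⇒≡ a≢b a≢c) mate
        where a≢c = λ a≡c → y≢φia (cong (φ i) (sym a≡c))

    core-mate : (K : K2 G p A) → ∀ {i a b} → a ≢ b → K2.φ K i a ∈ C → K2.φ K i b ∈ C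
    core-mate K {i} {a} {b} a≢b φia∈C = adjacent-mate⇒core K (a≢b ∘ sym)
      (Edge-sym G (core⇒adjacent φia∈C (K2.inA K i b) (φ-distinct-in-class K a≢b)))

    module Matching (M : Fin n → Fin n → Bool) (M-sym : ∀ u v → M u v ≡ M v u)
                    (M⊆E[A] : ∀ u v → M u v ≡ true → Edge G u v × u ∈ A × v ∈ A) where

      covers? : (K : K2 G p A) → Dec (Covers G M K)
      covers? K = map′
        (λ (i , j , a , b , i≢j , m) → φ i a , φ j b , (i , j , a , b , i≢j , refl , refl) , m)
        (λ { (_ , _ , (i , j , a , b , i≢j , refl , refl) , m) → i , j , a , b , i≢j , m })
        (any? λ i → any? λ j → any? λ a → any? λ b →
           ¬? (i ≟ᶠ j) ×-dec (M (φ i a) (φ j b) Bool.≟ true))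
        where open K2 K

      uncovered⇒perfectMatching : (∀ c → c ∈ C → ∃ λ v → M c v ≡ true) →
                                  (K : K2 G p A) → ¬ Covers G M K → PerfectMatching G C M
      uncovered⇒perfectMatching M-covers-C K ¬cov = matched⇒in-C , unique-partner
        where
        open K2 K
        within-class : ∀ {i a j b} → M (φ i a) (φ j b) ≡ true → i ≡ j
        within-class {i} {a} {j} {b} m with i ≟ᶠ j
        ... | yes i≡j = i≡j
        ... | no i≢j  = ⊥-elim (¬cov (_ , _ , (i , j , a , b , i≢j , refl , refl) , m))
        partner-in-class : ∀ {i a w} → M (φ i a) w ≡ true → ∃ λ b → a ≢ b × w ≡ φ i b
        partner-in-class {i} {a} m with K2-surjective K (proj₂ (proj₂ (M⊆E[A] _ _ m)))
        ... | j , b , refl with within-class m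
        ... | refl = b , (λ a≡b → Edge-irrefl G (proj₁ (M⊆E[A] _ _ m)) (cong (φ i) a≡b)) , refl
        matched⇒core : ∀ {u w} → M u w ≡ true → u ∈ C
        matched⇒core m with K2-surjective K (proj₁ (proj₂ (M⊆E[A] _ _ m)))
        ... | i , a , refl with partner-in-class m
        ... | b , a≢b , refl = adjacent-mate⇒core K a≢b (proj₁ (M⊆E[A] _ _ m))
        matched⇒in-C : ∀ u v → M u v ≡ true → Edge G u v × u ∈ C × v ∈ C
        matched⇒in-C u v m = proj₁ (M⊆E[A] u v m) , matched⇒core m , matched⇒core (trans (M-sym v u) m)
        unique-partner : ∀ c → c ∈ C → ∃ λ v → M c v ≡ true × (∀ w → M c w ≡ true → w ≡ v)
        unique-partner c c∈C with M-covers-C c c∈C | K2-surjective K (proj₁ (∈-core⁻ G c∈C))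
        ... | v , cMv | i , a , refl = v , cMv , λ w cMw → same-partner cMw cMv
          where
          same-partner : ∀ {w v} → M (φ i a) w ≡ true → M (φ i a) v ≡ true → w ≡ v
          same-partner m m′ with partner-in-class m | partner-in-class m′
          ... | b , a≢b , refl | b′ , a≢b′ , refl = cong (φ i) (≢-≢⇒≡ a≢b a≢b′)

      module _ (pm : PerfectMatching G C M) where

        partner-unique : ∀ {c v w} → c ∈ C → M c v ≡ true → M c w ≡ true → v ≡ w
        partner-unique c∈C cMv cMw with proj₂ pm _ c∈C
        ... | _ , _ , unique = trans (unique _ cMv) (sym (unique _ cMw))

        -- By core-mate a class meets C only if it lies inside C, so one vertex is tested.
        Aligned : K2 G p A → Fin p → Set
        Aligned K i = K2.φ K i zero ∉ C ⊎ M (K2.φ K i zero) (K2.φ K i (suc zero)) ≡ true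

        aligned-matched : (K : K2 G p A) → ∀ {i} a → Aligned K i →
                          K2.φ K i a ∈ C → M (K2.φ K i a) (K2.φ K i (other a)) ≡ true
        aligned-matched K zero       (inj₁ ∉C) ∈C = ⊥-elim (∉C ∈C)
        aligned-matched K zero       (inj₂ m)  _  = m
        aligned-matched K (suc zero) (inj₁ ∉C) ∈C = ⊥-elim (∉C (core-mate K (λ ()) ∈C))
        aligned-matched K (suc zero) (inj₂ m)  _  = trans (M-sym _ _) m

        aligned-partner : (K : K2 G p A) → ∀ {k} c {u} → Aligned K k →
                          M (K2.φ K k c) u ≡ true → u ≡ K2.φ K k (other c)
        aligned-partner K c aligned m =
          partner-unique φkc∈C m (aligned-matched K c aligned φkc∈C)
          where φkc∈C = proj₁ (proj₂ (proj₁ pm _ _ m))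

        aligned⇒uncovered : (K : K2 G p A) → (∀ i → Aligned K i) → ¬ Covers G M K
        aligned⇒uncovered K aligned (_ , _ , (i , j , a , b , i≢j , refl , refl) , m) =
          i≢j (sym (proj₁ (K2.inj K j b i (other a) (aligned-partner K a (aligned i) m))))

        repair : (K : K2 G p A) (i : Fin p) →
                 Σ (K2 G p A) λ K′ → Aligned K′ i × (∀ {k} → Aligned K k → Aligned K′ k)
        repair K i with K2.φ K i zero ∈? C | M (K2.φ K i zero) (K2.φ K i (suc zero)) Bool.≟ true
        ... | no u∉C  | _       = K , inj₁ u∉C , λ aligned → aligned
        ... | yes _   | yes uMw = K , inj₂ uMw , λ aligned → aligned
        -- Swap w with u's partner v: v is in no other aligned class, since its partner u is in class i.
        ... | yes u∈C | no ¬uMw = K2-swap v∈C w∈C K , inj₂ τuMτw , keep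
          where
          open K2 K
          u = φ i zero
          w = φ i (suc zero)
          v = proj₁ (proj₂ pm u u∈C)
          uMv = proj₁ (proj₂ (proj₂ pm u u∈C))
          v∈C = proj₂ (proj₂ (proj₁ pm u v uMv))
          w∈C = core-mate K (λ ()) u∈C
          τuMτw : M (transpose v w u) (transpose v w w) ≡ true
          τuMτw = subst₂ (λ x y → M x y ≡ true)
            (sym (transpose-fix (Edge-irrefl G (proj₁ (M⊆E[A] u v uMv))) (φ-distinct-in-class K (λ ()))))
            (sym (transpose-matchʳ v w)) uMv
          keep : ∀ {k} → Aligned K k → Aligned (K2-swap v∈C w∈C K) k
          keep {k} aligned with k ≟ᶠ i
          ... | yes refl = ⊥-elim ([ (λ u∉C → u∉C u∈C) , ¬uMw ]′ aligned)
          ... | no k≢i   = subst₂ (λ x y → x ∉ C ⊎ M x y ≡ true)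
            (sym (transpose-fixes-class zero)) (sym (transpose-fixes-class (suc zero))) aligned
            where
            φkc≢v : ∀ c → φ k c ≢ v
            φkc≢v c φkc≡v =
              k≢i (proj₁ (inj k (other c) i zero (sym (aligned-partner K c aligned φkcMu))))
              where φkcMu = subst (λ x → M x u ≡ true) (sym φkc≡v) (trans (M-sym v u) uMv)
            transpose-fixes-class : ∀ c → transpose v w (φ k c) ≡ φ k c
            transpose-fixes-class c =
              transpose-fix (φkc≢v c) (λ eq → k≢i (proj₁ (inj k c i (suc zero) eq)))

        aligned-on : K2 G p A → (is : List (Fin p)) → Σ (K2 G p A) λ K → All (Aligned K) is
        aligned-on K₀ []       = K₀ , []
        aligned-on K₀ (i ∷ is) with aligned-on K₀ is
        ... | K , aligned with repair K i
        ... | K′ , aligned-i , keep = K′ , aligned-i ∷ All.map keep aligned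

        perfectMatching⇒uncovered : K2 G p A → ∃ λ K → ¬ Covers G M K
        perfectMatching⇒uncovered K₀ with aligned-on K₀ (allFin p)
        ... | K , aligned = K , aligned⇒uncovered K (λ i → All.lookup aligned (∈-allFin i))

      covers-all⇔¬perfectMatching : K2 G p A → (∀ c → c ∈ C → ∃ λ v → M c v ≡ true) →
                                    (∀ K → Covers G M K) ⇔ (¬ PerfectMatching G C M)
      covers-all⇔¬perfectMatching K₀ M-covers-C = mk⇔ covers-all⇒¬pm ¬pm⇒covers-all
        where
        covers-all⇒¬pm : (∀ K → Covers G M K) → ¬ PerfectMatching G C M
        covers-all⇒¬pm covers pm with perfectMatching⇒uncovered pm K₀
        ... | K , ¬cov = ¬cov (covers K)
        ¬pm⇒covers-all : ¬ PerfectMatching G C M → ∀ K → Covers G M K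
        ¬pm⇒covers-all ¬pm K with covers? K
        ... | yes cov  = cov
        ... | no ¬cov = ⊥-elim (¬pm (uncovered⇒perfectMatching M-covers-C K ¬cov))

suc[2p∸2+1]≡2p : ∀ {p} → 1 ≤ p → suc ((2 * p ∸ 2) + 1) ≡ 2 * p
suc[2p∸2+1]≡2p {p} 1≤p = trans (sym (+-suc (2 * p ∸ 2) 1)) (m∸n+n≡m (*-monoʳ-≤ 2 1≤p))

lemma12 : (p : ℕ) → 3 ≤ p → (n : ℕ) → (G : Graph n) →
    (∀ v → deg G v ≤ (2 * p ∸ 2) + 1) →
    (A : Subset n) → Dense G p A →
    (k : ℕ) → ∣ core G ((2 * p ∸ 2) + 1) A ∣ ≡ 2 * k →
    (M : Fin n → Fin n → Bool) →
    (∀ u v → M u v ≡ M v u) →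
    (∀ u v → M u v ≡ true → Edge G u v × u ∈ A × v ∈ A) →
    (∀ c → c ∈ core G ((2 * p ∸ 2) + 1) A → ∃ λ v → M c v ≡ true) →
    ((∀ (K : K2 G p A) → Covers G M K)
       ⇔ (¬ PerfectMatching G (core G ((2 * p ∸ 2) + 1) A) M))
    × ((¬ PerfectMatching G (core G ((2 * p ∸ 2) + 1) A) M)
       ⇔ ((∃ λ c → c ∈ core G ((2 * p ∸ 2) + 1) A × ∃ λ v → ∃ λ w →
              v ≢ w × M c v ≡ true × M c w ≡ true)
          ⊎ (∃ λ u → ∃ λ v → M u v ≡ true × u ∈ A × u ∉ core G ((2 * p ∸ 2) + 1) A)))
lemma12 p 3≤p n G deg≤d A (∣A∣≡2p , K₀ , _) _ _ M M-sym M⊆E[A] M-covers-C =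
  covers-all⇔¬perfectMatching K₀ M-covers-C ,
  ¬perfectMatching⇔doublyMatched⊎touchesNonCore A C M G M-sym M⊆E[A] M-covers-C
  where
  ∣A∣≡1+d : ∣ A ∣ ≡ suc ((2 * p ∸ 2) + 1)
  ∣A∣≡1+d = trans ∣A∣≡2p (sym (suc[2p∸2+1]≡2p (≤-trans (s≤s z≤n) 3≤p)))
  open Saturated G deg≤d {A} ∣A∣≡1+d
  open Matching {p} ∣A∣≡2p M M-sym M⊆E[A]
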